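{- Let $n$, $a$, $q$, $r$ be integers such that either $n=qa$ with $a\ge 4$ and $q\ge 3$, or $n=qa+r$ with $q\ge 2$, $1\le r\le a-1$ and $4\le a\le r+q+1$. Then $\mathrm{diam}(\overrightarrow{C}(n;1,a)) = q+a-2$.
   Context: The oriented circulant graph $\overrightarrow{C}(n;1,a)$ has vertex set $\{v_0,\dots,v_{n-1}\}$ and arcs $v_kv_{k+1}$ and $v_kv_{k+a}$ for all $k$, subscripts modulo $n$. $d(u,v)$ is the length of a shortest directed path from $u$ to $v$; $e(v)=\max_u d(v,u)$; $\mathrm{diam}$ is the maximum eccentricity. -}

module Defs where

open import Data.Nat using (ℕ; zero; suc; _+_; _<_; _≤_; NonZero)
open import Data.Nat.DivMod using (_%_)
open import Data.Product using (Σ; _×_; ∃-syntax; proj₁)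
open import Data.Sum using (_⊎_)
open import Relation.Binary.PropositionalEquality using (_≡_)

-- Oriented circulant graph C(n;1,a): vertices v_0..v_{n-1} represented by
-- naturals k < n; arcs v_k → v_{(k+1) mod n} and v_k → v_{(k+a) mod n}.
module Circulant (n a : ℕ) .{{_ : NonZero n}} where

  Vertex : Set
  Vertex = Σ ℕ (λ k → k < n)

  Arc : ℕ → ℕ → Set
  Arc u v = (v ≡ (u + 1) % n) ⊎ (v ≡ (u + a) % n)

  data Walk : ℕ → ℕ → ℕ → Set where
    here : ∀ {u} → Walk u u 0
    step : ∀ {u w v k} → Arc u w → Walk w v k → Walk u v (suc k)

  IsDist : ℕ → ℕ → ℕ → Set
  IsDist u v k = Walk u v k × (∀ m → Walk u v m → k ≤ m)

  IsDiam : ℕ → Set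
  IsDiam D =
    (∀ (u v : Vertex) → ∃[ k ] (IsDist (proj₁ u) (proj₁ v) k × k ≤ D))
    × ∃[ u ] ∃[ v ] IsDist (proj₁ {B = λ k → k < n} u) (proj₁ {B = λ k → k < n} v) D

{-# OPTIONS --safe #-}
-- A walk with i unit arcs and j a-arcs leads from u to u + i + j a (mod n), and among all
-- ways of writing x = i + j a the greedy one, x mod a unit arcs and x div a long arcs, uses
-- the fewest arcs.  So every vertex is reached within the greedy length of some x < qa + r,
-- which is at most q + a - 2.  Conversely a walk from 0 to qa - 1 is at least as long as the
-- greedy length of some lift qa - 1 + M n: for M = 0 this is exactly q + a - 2, and for
-- M ≥ 1 the hypothesis r = 0 or a ≤ r + q + 1 prevents the lift from being cheaper.
module Submission where

open import Defs
open import Data.Nat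
  using (ℕ; zero; suc; _+_; _*_; _∸_; _≤_; _<_; NonZero; >-nonZero⁻¹; z<s; s≤s⁻¹; _≟_; _≤?_; _<?_)
open import Data.Nat.Properties
open import Data.Nat.DivMod
open import Data.Nat.Divisibility using (n∣m*n)
open import Data.Nat.Tactic.RingSolver using (solve-∀; solve)
open import Data.Fin using (Fin; toℕ; fromℕ; fromℕ<; inject)
open import Data.Fin.Properties using (¬∀⟶∃¬-smallest; toℕ-fromℕ; toℕ-fromℕ<; toℕ-inject)
open import Data.List using (_∷_; [])
open import Data.Product using (_×_; _,_; ∃-syntax; proj₁; proj₂; map₂)
open import Data.Sum using (_⊎_; inj₁; inj₂)
open import Relation.Nullary using (¬_; Dec; yes; no; ¬?; contradiction)
open import Relation.Nullary.Decidable using (map′; _⊎-dec_; decidable-stable)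
open import Relation.Unary using (Pred; Decidable)
open import Relation.Binary.PropositionalEquality

least-witness : ∀ {p} {P : Pred ℕ p} → Decidable P → ∀ {N} → P N →
                ∃[ k ] (P k × (∀ m → P m → k ≤ m))
least-witness {P = P} P? {N} pN
  with ¬∀⟶∃¬-smallest (suc N) (λ i → ¬ P (toℕ i)) (λ i → ¬? (P? (toℕ i)))
         (λ none → none (fromℕ N) (subst P (sym (toℕ-fromℕ N)) pN))
... | i , ¬¬pi , below = toℕ i , decidable-stable (P? (toℕ i)) ¬¬pi , minimal
  where
  minimal : ∀ m → P m → toℕ i ≤ m
  minimal m pm with toℕ i ≤? m
  ... | yes i≤m = i≤m
  ... | no i≰m = contradiction (subst P (sym toℕ-j≡m) pm) (below j)
    where
    m<i : m < toℕ i
    m<i = ≰⇒> i≰m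
    j : Fin (toℕ i)
    j = fromℕ< m<i
    toℕ-j≡m : toℕ (inject j) ≡ m
    toℕ-j≡m = trans (toℕ-inject j) (toℕ-fromℕ< m<i)

[m%n+o]%n≡[m+o]%n : ∀ m o n .{{_ : NonZero n}} → (m % n + o) % n ≡ (m + o) % n
[m%n+o]%n≡[m+o]%n m o n = begin
  (m % n + o) % n          ≡⟨ %-distribˡ-+ (m % n) o n ⟩
  (m % n % n + o % n) % n  ≡⟨ cong (λ x → (x + o % n) % n) (m%n%n≡m%n m n) ⟩
  (m % n + o % n) % n      ≡⟨ %-distribˡ-+ m o n ⟨
  (m + o) % n              ∎
  where open ≡-Reasoning

[m+[o+[n∸m]]%n]%n≡o : ∀ {m o n} .{{_ : NonZero n}} → m ≤ n → o < n →
                      (m + (o + (n ∸ m)) % n) % n ≡ o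
[m+[o+[n∸m]]%n]%n≡o {m} {o} {n} m≤n o<n = begin
  (m + (o + (n ∸ m)) % n) % n      ≡⟨ cong (_% n) (+-comm m _) ⟩
  ((o + (n ∸ m)) % n + m) % n      ≡⟨ [m%n+o]%n≡[m+o]%n (o + (n ∸ m)) m n ⟩
  (o + (n ∸ m) + m) % n            ≡⟨ cong (_% n) (+-assoc o (n ∸ m) m) ⟩
  (o + (n ∸ m + m)) % n            ≡⟨ cong (λ x → (o + x) % n) (m∸n+n≡m m≤n) ⟩
  (o + n) % n                      ≡⟨ [m+n]%n≡m%n o n ⟩
  o % n                            ≡⟨ m<n⇒m%n≡m o<n ⟩
  o                                ∎
  where open ≡-Reasoning

greedyLength : (a x : ℕ) .{{_ : NonZero a}} → ℕ
greedyLength a x = x % a + x / a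

greedyLength-≤ : ∀ {a} .{{_ : NonZero a}} i j → greedyLength a (i + j * a) ≤ i + j
greedyLength-≤ {a} i j = begin
  (i + j * a) % a + (i + j * a) / a  ≡⟨ cong₂ _+_ ([m+kn]%n≡m%n i j a) (+-distrib-/-∣ʳ i (n∣m*n j)) ⟩
  i % a + (i / a + j * a / a)        ≡⟨ cong (λ y → i % a + (i / a + y)) (m*n/n≡m j a) ⟩
  i % a + (i / a + j)                ≡⟨ +-assoc (i % a) (i / a) j ⟨
  i % a + i / a + j                  ≤⟨ +-monoˡ-≤ j (+-monoʳ-≤ (i % a) (m≤m*n (i / a) a)) ⟩
  i % a + i / a * a + j              ≡⟨ cong (_+ j) (m≡m%n+[m/n]*n i a) ⟨
  i + j                              ∎
  where open ≤-Reasoning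

greedyLength-≤-q+a∸2 : ∀ {q a r x} .{{_ : NonZero a}} → r < a → x < q * a + r →
                       greedyLength a x ≤ q + a ∸ 2
greedyLength-≤-q+a∸2 {q} {a} {r} {x} r<a x<n = m+n≤o⇒m≤o∸n (greedyLength a x) (begin
  x % a + x / a + 2          ≡⟨ m+n+2≡1+m+1+n (x % a) (x / a) ⟩
  suc (x % a) + suc (x / a)  ≤⟨ digits-bound (m≤n⇒m<n∨m≡n x/a≤q) ⟩
  a + q                      ≡⟨ +-comm a q ⟩
  q + a                      ∎)
  where
  open ≤-Reasoning
  m+n+2≡1+m+1+n : ∀ m n → m + n + 2 ≡ suc m + suc n
  m+n+2≡1+m+1+n = solve-∀
  x/a≤q : x / a ≤ q
  x/a≤q = s≤s⁻¹ (*-cancelʳ-< a (x / a) (suc q) (begin-strict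
    x / a * a   ≤⟨ m/n*n≤m x a ⟩
    x           <⟨ x<n ⟩
    q * a + r   <⟨ +-monoʳ-< (q * a) r<a ⟩
    q * a + a   ≡⟨ +-comm (q * a) a ⟩
    suc q * a   ∎))
  digits-bound : x / a < q ⊎ x / a ≡ q → suc (x % a) + suc (x / a) ≤ a + q
  digits-bound (inj₁ x/a<q) = +-mono-≤ (m%n<n x a) x/a<q
  digits-bound (inj₂ x/a≡q) = begin
    suc (x % a) + suc (x / a)  ≤⟨ +-monoˡ-≤ (suc (x / a)) x%a<r ⟩
    r + suc (x / a)            ≡⟨ +-suc r (x / a) ⟩
    suc r + x / a              ≤⟨ +-mono-≤ r<a (≤-reflexive x/a≡q) ⟩
    a + q                      ∎
    where
    x%a<r : x % a < r
    x%a<r = +-cancelˡ-< (q * a) (x % a) r (begin-strict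
      q * a + x % a        ≡⟨ cong (λ y → y * a + x % a) x/a≡q ⟨
      x / a * a + x % a    ≡⟨ +-comm (x / a * a) (x % a) ⟩
      x % a + x / a * a    ≡⟨ m≡m%n+[m/n]*n x a ⟨
      x                    <⟨ x<n ⟩
      q * a + r            ∎)

wrap-around-bound : ∀ {q a r} M c s .{{_ : NonZero a}} → r < a → (r ≡ 0 ⊎ a ≤ r + q + 1) →
                    c * a + suc s ≡ M * r → a ≤ M * q + c + s + 2
wrap-around-bound M c s r<a (inj₁ refl) eq =
  contradiction (trans eq (*-zeroʳ M)) (m+1+n≢0 (c * _))
wrap-around-bound {q} {a} {r} M c s r<a (inj₂ a≤r+q+1) eq with m≤n⇒∃[o]m+o≡n c<M
  where
  c<M : c < M
  c<M = *-cancelʳ-< a c M (begin-strict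
    c * a          <⟨ m<m+n (c * a) z<s ⟩
    c * a + suc s  ≡⟨ eq ⟩
    M * r          ≤⟨ *-monoʳ-≤ M (<⇒≤ r<a) ⟩
    M * a          ∎)
    where open ≤-Reasoning
... | d , refl = +-cancelʳ-≤ d a _ (+-cancelˡ-≤ (c * a) _ _ (begin
  c * a + (a + d)                ≤⟨ +-monoʳ-≤ (c * a) (+-monoʳ-≤ a (m≤m*n d a)) ⟩
  c * a + (a + d * a)            ≡⟨ solve (c ∷ d ∷ a ∷ []) ⟩
  M * a                          ≤⟨ *-monoʳ-≤ M a≤r+q+1 ⟩
  M * (r + q + 1)                ≡⟨ solve (c ∷ d ∷ r ∷ q ∷ []) ⟩
  M * r + (M * q + M)            ≡⟨ cong (_+ (M * q + M)) eq ⟨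
  c * a + suc s + (M * q + M)    ≡⟨ solve (c ∷ d ∷ a ∷ s ∷ q ∷ []) ⟩
  c * a + (M * q + c + s + 2 + d) ∎))
  where open ≤-Reasoning

-- J a + s is the greedy form of the lift qa - 1 + M n.  If J < q + M q there is no room left
-- below (q + M q) a; otherwise the excess c = J - (q + M q) satisfies c a + s + 1 = M r.
q+a≤digit-sum : ∀ {q a r} M J s .{{_ : NonZero a}} → s < a → r < a → (r ≡ 0 ⊎ a ≤ r + q + 1) →
                J * a + suc s ≡ (q + M * q) * a + M * r → q + a ≤ 2 + (s + J)
q+a≤digit-sum {q} {a} {r} M J s s<a r<a admissible eq with J <? q + M * q
... | yes J<Q = begin
  q + a          ≤⟨ +-mono-≤ (≤-trans (m≤m+n q (M * q)) Q≤1+J) a≤1+s ⟩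
  suc J + suc s  ≡⟨ solve (J ∷ s ∷ []) ⟩
  2 + (s + J)    ∎
  where
  open ≤-Reasoning
  Qa≤Ja+1+s : (q + M * q) * a ≤ J * a + suc s
  Qa≤Ja+1+s = subst ((q + M * q) * a ≤_) (sym eq) (m≤m+n _ (M * r))
  Q≤1+J : q + M * q ≤ suc J
  Q≤1+J = *-cancelʳ-≤ (q + M * q) (suc J) a (≤-trans Qa≤Ja+1+s (begin
    J * a + suc s  ≤⟨ +-monoʳ-≤ (J * a) s<a ⟩
    J * a + a      ≡⟨ +-comm (J * a) a ⟩
    suc J * a      ∎))
  a≤1+s : a ≤ suc s
  a≤1+s = +-cancelˡ-≤ (J * a) a (suc s) (begin
    J * a + a          ≡⟨ +-comm (J * a) a ⟩
    suc J * a          ≤⟨ *-monoˡ-≤ a J<Q ⟩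
    (q + M * q) * a    ≤⟨ Qa≤Ja+1+s ⟩
    J * a + suc s      ∎)
... | no J≮Q with m≤n⇒∃[o]m+o≡n (≮⇒≥ J≮Q)
...   | c , refl = begin
  q + a                        ≤⟨ +-monoʳ-≤ q (wrap-around-bound M c s r<a admissible ca+1+s≡Mr) ⟩
  q + (M * q + c + s + 2)      ≡⟨ solve (q ∷ M ∷ c ∷ s ∷ []) ⟩
  2 + (s + (q + M * q + c))    ∎
  where
  open ≤-Reasoning
  ca+1+s≡Mr : c * a + suc s ≡ M * r
  ca+1+s≡Mr = +-cancelˡ-≡ ((q + M * q) * a) _ _ (begin-equality
    (q + M * q) * a + (c * a + suc s)  ≡⟨ solve (q ∷ M ∷ c ∷ a ∷ s ∷ []) ⟩
    (q + M * q + c) * a + suc s        ≡⟨ eq ⟩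
    (q + M * q) * a + M * r            ∎)

q+a∸2≤greedyLength : ∀ {q a r} M x .{{_ : NonZero a}} → r < a → (r ≡ 0 ⊎ a ≤ r + q + 1) →
                     suc x ≡ q * a + M * (q * a + r) → q + a ∸ 2 ≤ greedyLength a x
q+a∸2≤greedyLength {q} {a} {r} M x r<a admissible eq =
  m≤n+o⇒m∸n≤o (q + a) 2 (q+a≤digit-sum M (x / a) (x % a) (m%n<n x a) r<a admissible (begin
    x / a * a + suc (x % a)   ≡⟨ +-suc (x / a * a) (x % a) ⟩
    suc (x / a * a + x % a)   ≡⟨ cong suc (+-comm (x / a * a) (x % a)) ⟩
    suc (x % a + x / a * a)   ≡⟨ cong suc (m≡m%n+[m/n]*n x a) ⟨
    suc x                     ≡⟨ eq ⟩
    q * a + M * (q * a + r)   ≡⟨ solve (q ∷ a ∷ M ∷ r ∷ []) ⟩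
    (q + M * q) * a + M * r   ∎))
  where open ≡-Reasoning

module CirculantWalks (n a : ℕ) .{{_ : NonZero n}} where
  open Circulant n a

  walk? : ∀ u v k → Dec (Walk u v k)
  walk? u v zero = map′ (λ { refl → here }) (λ { here → refl }) (u ≟ v)
  walk? u v (suc k) =
    map′ (λ { (inj₁ w) → step (inj₁ refl) w ; (inj₂ w) → step (inj₂ refl) w })
         (λ { (step (inj₁ refl) w) → inj₁ w ; (step (inj₂ refl) w) → inj₂ w })
         (walk? ((u + 1) % n) v k ⊎-dec walk? ((u + a) % n) v k)

  walk⇒steps : ∀ {u v k} → Walk u v k →
               ∃[ i ] ∃[ j ] (i + j ≡ k × (u + (i + j * a)) % n ≡ v % n)
  walk⇒steps {u} here = 0 , 0 , refl , cong (_% n) (+-identityʳ u)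
  walk⇒steps {u} {v} (step (inj₁ refl) w) with walk⇒steps w
  ... | i , j , refl , reach = suc i , j , refl , (begin
    (u + suc (i + j * a)) % n         ≡⟨ cong (_% n) (+-assoc u 1 (i + j * a)) ⟨
    (u + 1 + (i + j * a)) % n         ≡⟨ [m%n+o]%n≡[m+o]%n (u + 1) (i + j * a) n ⟨
    ((u + 1) % n + (i + j * a)) % n   ≡⟨ reach ⟩
    v % n                             ∎)
    where open ≡-Reasoning
  walk⇒steps {u} {v} (step (inj₂ refl) w) with walk⇒steps w
  ... | i , j , refl , reach = i , suc j , +-suc i j , (begin
    (u + (i + (a + j * a))) % n       ≡⟨ cong (_% n) (solve (u ∷ i ∷ a ∷ j ∷ [])) ⟩
    (u + a + (i + j * a)) % n         ≡⟨ [m%n+o]%n≡[m+o]%n (u + a) (i + j * a) n ⟨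
    ((u + a) % n + (i + j * a)) % n   ≡⟨ reach ⟩
    v % n                             ∎)
    where open ≡-Reasoning

  steps⇒walk : ∀ u i j → Walk (u % n) ((u + (i + j * a)) % n) (i + j)
  steps⇒walk u zero zero = subst (λ v → Walk (u % n) (v % n) 0) (sym (+-identityʳ u)) here
  steps⇒walk u (suc i) j = step (inj₁ (sym ([m%n+o]%n≡[m+o]%n u 1 n)))
    (subst (λ v → Walk ((u + 1) % n) (v % n) (i + j)) (+-assoc u 1 (i + j * a))
           (steps⇒walk (u + 1) i j))
  steps⇒walk u zero (suc j) = step (inj₂ (sym ([m%n+o]%n≡[m+o]%n u a n)))
    (subst (λ v → Walk ((u + a) % n) (v % n) j) (+-assoc u a (j * a))
           (steps⇒walk (u + a) zero j))

  greedy-walk : ∀ {u} x .{{_ : NonZero a}} → u < n → Walk u ((u + x) % n) (greedyLength a x)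
  greedy-walk {u} x u<n =
    subst₂ (λ s y → Walk s ((u + y) % n) (greedyLength a x))
           (m<n⇒m%n≡m u<n) (sym (m≡m%n+[m/n]*n x a)) (steps⇒walk u (x % a) (x / a))

  walk⇒lift-greedyLength≤length : ∀ {v k} .{{_ : NonZero a}} → Walk 0 v k →
                                  ∃[ M ] greedyLength a (v % n + M * n) ≤ k
  walk⇒lift-greedyLength≤length {v} w with walk⇒steps w
  ... | i , j , refl , reach =
    x / n , subst (λ y → greedyLength a y ≤ i + j) x≡ (greedyLength-≤ i j)
    where
    x : ℕ
    x = i + j * a
    x≡ : x ≡ v % n + x / n * n
    x≡ = trans (m≡m%n+[m/n]*n x n) (cong (_+ x / n * n) reach)

diameter-q+a∸2 : ∀ n a q r .{{_ : NonZero n}} → 0 < q → n ≡ q * a + r → r < a →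
                 (r ≡ 0 ⊎ a ≤ r + q + 1) → Circulant.IsDiam n a (q + a ∸ 2)
diameter-q+a∸2 n a@(suc a′) q@(suc q′) r z<s n≡qa+r r<a admissible =
  (λ (u , u<n) (v , v<n) → distance u<n v<n) , (0 , 0<n) , (v₀ , v₀<n) , distance-0-v₀
  where
  open Circulant n a
  open CirculantWalks n a

  D : ℕ
  D = q + a ∸ 2

  0<n : 0 < n
  0<n = >-nonZero⁻¹ n

  distance : ∀ {u v} → u < n → v < n → ∃[ k ] (IsDist u v k × k ≤ D)
  distance {u} {v} u<n v<n =
    map₂ (λ dist → dist , ≤-trans (proj₂ dist _ walk) x-bound) (least-witness (walk? u v) walk)
    where
    x : ℕ
    x = (v + (n ∸ u)) % n
    x-bound : greedyLength a x ≤ D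
    x-bound = greedyLength-≤-q+a∸2 {q = q} r<a (subst (x <_) n≡qa+r (m%n<n _ n))
    walk : Walk u v (greedyLength a x)
    walk = subst (λ y → Walk u y (greedyLength a x))
                 ([m+[o+[n∸m]]%n]%n≡o (<⇒≤ u<n) v<n) (greedy-walk x u<n)

  -- v₀ = qa - 1, written so that suc v₀ reduces to q * a.
  v₀ : ℕ
  v₀ = a′ + q′ * a

  v₀<n : v₀ < n
  v₀<n = subst (q * a ≤_) (sym n≡qa+r) (m≤m+n (q * a) r)

  D≤length : ∀ {m} → Walk 0 v₀ m → D ≤ m
  D≤length w with walk⇒lift-greedyLength≤length w
  ... | M , lift≤m = ≤-trans (q+a∸2≤greedyLength M _ r<a admissible lift) lift≤m
    where
    lift : suc (v₀ % n + M * n) ≡ q * a + M * (q * a + r)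
    lift = cong₂ (λ y z → suc (y + M * z)) (m<n⇒m%n≡m v₀<n) n≡qa+r

  distance-0-v₀ : IsDist 0 v₀ D
  distance-0-v₀ with distance 0<n v₀<n
  ... | k , dist , k≤D = subst (IsDist 0 v₀) (≤-antisym k≤D (D≤length (proj₁ dist))) dist

proposition10 : (n a q r : ℕ) → .{{_ : NonZero n}} →
    ((n ≡ q * a × 4 ≤ a × 3 ≤ q)
      ⊎ (n ≡ q * a + r × 2 ≤ q × 1 ≤ r × r ≤ a ∸ 1 × 4 ≤ a × a ≤ r + q + 1)) →
    Circulant.IsDiam n a (q + a ∸ 2)
proposition10 n a q r (inj₁ (n≡qa , 4≤a , 3≤q)) =
  diameter-q+a∸2 n a q 0 (<-≤-trans z<s 3≤q) (trans n≡qa (sym (+-identityʳ (q * a))))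
                 (<-≤-trans z<s 4≤a) (inj₁ refl)
proposition10 n a q r (inj₂ (n≡qa+r , 2≤q , _ , r≤a∸1 , 4≤a , a≤r+q+1)) =
  diameter-q+a∸2 n a q r (<-≤-trans z<s 2≤q) n≡qa+r r<a (inj₂ a≤r+q+1)
  where
  r<a : r < a
  r<a = subst (_≤ a) (+-comm r 1) (m≤o∸n⇒m+n≤o r (<-≤-trans z<s 4≤a) r≤a∸1)
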